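{- Let $G$ be a $k$-tree with at least $k+4$ vertices. Then $G$ does not contain two adjacent vertices $v,w$, both of degree $k+1$, such that each of $v$ and $w$ is adjacent to a vertex of degree at most $k$.
   Context: Graphs are finite, simple and undirected. $G$ is a $k$-tree if it has a vertex ordering $\phi$ such that for every vertex $v$ the neighbours of $v$ preceding $v$ form a clique and their number equals $\min(k,\phi(v)-1)$. -}

module Defs where

open import Data.Nat using (ℕ; _⊓_; _+_; _≤_)
open import Data.Fin using (Fin; toℕ; _<_)
open import Data.Bool using (Bool; true; false; _∧_)
open import Data.List using (List; filter; length)
open import Data.List using () renaming (allFin to allFinL)
open import Data.Product using (Σ; _×_; ∃-syntax; _,_)
open import Relation.Binary.PropositionalEquality using (_≡_; _≢_)
open import Relation.Nullary using (¬_)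
open import Function.Bundles using (_↔_; Inverse)
open import Data.Fin.Properties using (_<?_)

record Graph (n : ℕ) : Set where
  field
    adj     : Fin n → Fin n → Bool
    sym     : ∀ u v → adj u v ≡ adj v u
    irrefl  : ∀ v → adj v v ≡ false

open Graph public

Adj : ∀ {n} → Graph n → Fin n → Fin n → Set
Adj G u v = adj G u v ≡ true

degree : ∀ {n} → Graph n → Fin n → ℕ
degree {n} G v = length (filter (λ u → adj G v u ≟b true) (allFinL n))
  where
  open import Data.Bool.Properties using () renaming (_≟_ to _≟b_)

-- Given a vertex ordering φ (position of each vertex, 0-indexed, so
-- φ v = ϕ(v) - 1 in the paper's 1-indexed notation), the number of
-- neighbours of v preceding v.
predDegree : ∀ {n} → Graph n → (Fin n → Fin n) → Fin n → ℕ
predDegree {n} G φ v =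
  length (filter (λ u → Data.Bool.Properties.T? (adj G v u) Relation.Nullary.×-dec (φ u <? φ v)) (allFinL n))
  where
  import Data.Bool.Properties
  import Relation.Nullary

-- G is a k-tree: there is a vertex ordering φ (a bijection from vertices to
-- positions) such that for every vertex v, the earlier neighbours of v form a
-- clique and their number is min(k, ϕ(v) - 1) = min(k, toℕ (φ v)).
IsKTree : ∀ {n} → ℕ → Graph n → Set
IsKTree {n} k G =
  ∃[ φ ] (Σ (Fin n → Fin n) λ ψ →
      (∀ v → ψ (φ v) ≡ v) × (∀ i → φ (ψ i) ≡ i)
    × (∀ v u w → Adj G v u → φ u < φ v → Adj G v w → φ w < φ v → u ≢ w → Adj G u w)
    × (∀ v → predDegree G φ v ≡ k ⊓ toℕ (φ v)))

{-# OPTIONS --safe #-}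
-- Order the vertices as in the definition of a k-tree. Only the predecessor counts are used: a
-- vertex at position p ≤ k is adjacent to all p earlier vertices, so the first k + 1 vertices form a
-- clique, while a vertex at position k + j misses exactly j earlier vertices. Call a later neighbour
-- outside this initial clique a child. Every vertex has degree at least k plus its number of
-- children, so x and y have no children and v and w at most one. Hence a vertex beyond the initial
-- clique is never adjacent to an earlier x or y, nor to an earlier v or w unless it is their child.
-- Going through the possible shapes of the edges vw, vx and wy, one of the vertices at positions
-- k + 1, k + 2, k + 3 then misses too many earlier vertices.
module Submission where

open import Defs hiding (sym)
open import Data.Nat using (ℕ; suc; _+_; _≤_; _<_; _⊓_; z≤n; s≤s; _≤?_)
open import Data.Nat.Properties
  using (≤-refl; ≤-trans; ≮⇒≥; <-trans; ≤-<-trans; <-≤-trans; <⇒≤; <-irrefl; <-asym; <⇒≱; <-cmp; ≰⇒>;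
         n≮n;          +-comm; +-identityʳ; m<m+n;
         +-monoʳ-<; +-cancelˡ-≤; m≤m+n; m+1+n≰m; m≤n⇒m⊓n≡m; m≥n⇒m⊓n≡n)
open import Data.Fin using (Fin; toℕ; fromℕ<; inject≤; punchIn; _≟_)
open import Data.Fin.Properties
  using (toℕ-injective; toℕ-fromℕ<; toℕ-inject≤; toℕ≤pred[n]; inject≤-injective;
         punchIn-injective; punchInᵢ≢i; _<?_)
open import Data.List using (List; []; _∷_; length; _++_; map; filter) renaming (allFin to allFinL)
open import Data.List.Properties using (length-++; length-map; length-upTo; length-tabulate)
open import Data.List.Membership.Propositional using (_∈_)
open import Data.List.Membership.Propositional.Properties
  using (∈-filter⁺; ∈-filter⁻; ∈-allFin; ∈-upTo⁺)
open import Data.List.Relation.Binary.Subset.Propositional using (_⊆_)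
open import Data.List.Relation.Unary.Any using (here; there)
open import Data.List.Relation.Unary.All as All using (All; []; _∷_)
import Data.List.Relation.Unary.All.Properties as All
open import Data.List.Relation.Unary.AllPairs using ([]; _∷_)
open import Data.List.Relation.Unary.Unique.Propositional using (Unique)
import Data.List.Relation.Unary.Unique.Propositional.Properties as Unique
open import Data.Bool using (true)
open import Data.Bool.Properties using (T?; T-≡) renaming (_≟_ to _≟ᵇ_)
open import Data.Product using (_×_; _,_; proj₁; proj₂; ∃-syntax)
open import Data.Sum using (_⊎_; inj₁; inj₂)
open import Data.Empty using (⊥; ⊥-elim)
open import Relation.Nullary using (¬_; Dec; yes; no; _×-dec_; _⊎-dec_)
open import Relation.Nullary.Decidable using (decidable-stable)
open import Relation.Binary using (tri<; tri≈; tri>)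
open import Relation.Binary.PropositionalEquality
  using (_≡_; _≢_; refl; sym; trans; cong; subst; subst₂; module ≡-Reasoning)
open import Function using (_∘_)
open import Function.Bundles using (Equivalence)

module _ {a} {A : Set a} where

  private
    ∈-remove : ∀ {x : A} {ys} → x ∈ ys →
      ∃[ ys′ ] (length ys ≡ suc (length ys′) × (∀ {z} → z ∈ ys → z ≢ x → z ∈ ys′))
    ∈-remove {ys = y ∷ ys} (here refl) =
      ys , refl , λ { (here refl) z≢x → ⊥-elim (z≢x refl) ; (there z∈) _ → z∈ }
    ∈-remove {ys = y ∷ ys} (there x∈) with ys′ , eq , keep ← ∈-remove x∈ =
      y ∷ ys′ , cong suc eq , λ { (here refl) _ → here refl ; (there z∈) z≢x → there (keep z∈ z≢x) }

  Unique-⊆⇒length≤ : ∀ {xs ys : List A} → Unique xs → xs ⊆ ys → length xs ≤ length ys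
  Unique-⊆⇒length≤ {[]}     _            _   = z≤n
  Unique-⊆⇒length≤ {x ∷ xs} (x∉xs ∷ uxs) sub with ys′ , eq , keep ← ∈-remove (sub (here refl)) =
    subst (suc (length xs) ≤_) (sym eq)
      (s≤s (Unique-⊆⇒length≤ uxs λ z∈ → keep (sub (there z∈)) λ { refl → All.lookup x∉xs z∈ refl }))

Unique-<⇒length≤ : ∀ {m} {ns : List ℕ} → Unique ns → All (_< m) ns → length ns ≤ m
Unique-<⇒length≤ {m} uns ns<m =
  subst (_ ≤_) (length-upTo m) (Unique-⊆⇒length≤ uns (∈-upTo⁺ ∘ All.lookup ns<m))

pigeonhole₃ : ∀ {a} {A : Set a} {x y p q r : A} →
              p ≡ x ⊎ p ≡ y → q ≡ x ⊎ q ≡ y → r ≡ x ⊎ r ≡ y → p ≢ q → p ≢ r → q ≢ r → ⊥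
pigeonhole₃ (inj₁ refl) (inj₁ refl) _           p≢q _   _   = p≢q refl
pigeonhole₃ (inj₂ refl) (inj₂ refl) _           p≢q _   _   = p≢q refl
pigeonhole₃ (inj₁ refl) _           (inj₁ refl) _   p≢r _   = p≢r refl
pigeonhole₃ (inj₂ refl) _           (inj₂ refl) _   p≢r _   = p≢r refl
pigeonhole₃ _           (inj₁ refl) (inj₁ refl) _   _   q≢r = q≢r refl
pigeonhole₃ _           (inj₂ refl) (inj₂ refl) _   _   q≢r = q≢r refl

module KTreeOrdering {k n : ℕ} (G : Graph n) (φ ψ : Fin n → Fin n)
  (ψ∘φ : ∀ v → ψ (φ v) ≡ v) (φ∘ψ : ∀ i → φ (ψ i) ≡ i)
  (predDegree≡ : ∀ v → predDegree G φ v ≡ k ⊓ toℕ (φ v)) where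

  pos : Fin n → ℕ
  pos v = toℕ (φ v)

  pos-injective : ∀ {u w} → pos u ≡ pos w → u ≡ w
  pos-injective {u} {w} eq = trans (sym (ψ∘φ u)) (trans (cong ψ (toℕ-injective eq)) (ψ∘φ w))

  pos<⇒≢ : ∀ {u w} → pos u < pos w → u ≢ w
  pos<⇒≢ u<w refl = <-irrefl refl u<w

  pos>⇒≢ : ∀ {u w} → pos w < pos u → u ≢ w
  pos>⇒≢ w<u refl = <-irrefl refl w<u

  pos-ψ : ∀ i → pos (ψ i) ≡ toℕ i
  pos-ψ i = cong toℕ (φ∘ψ i)

  ψ-injective : ∀ {i j} → ψ i ≡ ψ j → i ≡ j
  ψ-injective {i} {j} eq = trans (sym (φ∘ψ i)) (trans (cong φ eq) (φ∘ψ j))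

  Adj-sym : ∀ {u w} → Adj G u w → Adj G w u
  Adj-sym {u} {w} uw = trans (Graph.sym G w u) uw

  Adj⇒≢ : ∀ {u w} → Adj G u w → u ≢ w
  Adj⇒≢ {u} uu refl with () ← trans (sym uu) (irrefl G u)

  Adj? : ∀ u w → Dec (Adj G u w)
  Adj? u w = adj G u w ≟ᵇ true

  earlierNeighbours : Fin n → List (Fin n)
  earlierNeighbours v = filter (λ u → T? (adj G v u) ×-dec (φ u <? φ v)) (allFinL n)

  ∈-earlierNeighbours⁻ : ∀ {v u} → u ∈ earlierNeighbours v → Adj G v u × pos u < pos v
  ∈-earlierNeighbours⁻ {v} u∈
    with _ , (vu , u<v) ← ∈-filter⁻ (λ u → T? (adj G v u) ×-dec (φ u <? φ v)) {xs = allFinL n} u∈ =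
    Equivalence.to T-≡ vu , u<v

  earlierNeighbours-unique : ∀ v → Unique (earlierNeighbours v)
  earlierNeighbours-unique v = Unique.filter⁺ _ (Unique.allFin⁺ n)

  Unique-Adj⇒length≤degree : ∀ {v zs} → Unique zs → All (Adj G v) zs → length zs ≤ degree G v
  Unique-Adj⇒length≤degree {v} uzs vzs =
    Unique-⊆⇒length≤ uzs λ {z} z∈ →
      ∈-filter⁺ (λ u → adj G v u ≟ᵇ true) (∈-allFin z) (All.lookup vzs z∈)

  EarlierNonNeighbour : Fin n → Fin n → Set
  EarlierNonNeighbour c z = pos z < pos c × ¬ Adj G c z

  earlierNonNeighbours-bound : ∀ {c zs} → Unique zs → All (EarlierNonNeighbour c) zs →
                               k ⊓ pos c + length zs ≤ pos c
  earlierNonNeighbours-bound {c} {zs} uzs czs =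
    subst (_≤ pos c) length-positions (Unique-<⇒length≤ positions-unique positions<c)
    where
    open ≡-Reasoning
    positions : List ℕ
    positions = map pos (earlierNeighbours c ++ zs)

    disjoint : ∀ {z} → ¬ (z ∈ earlierNeighbours c × z ∈ zs)
    disjoint (z∈ₑ , z∈) = proj₂ (All.lookup czs z∈) (proj₁ (∈-earlierNeighbours⁻ z∈ₑ))

    positions-unique : Unique positions
    positions-unique = Unique.map⁺ pos-injective (Unique.++⁺ (earlierNeighbours-unique c) uzs disjoint)

    positions<c : All (_< pos c) positions
    positions<c = All.map⁺ (All.++⁺ (All.tabulate (proj₂ ∘ ∈-earlierNeighbours⁻)) (All.map proj₁ czs))

    length-positions : length positions ≡ k ⊓ pos c + length zs
    length-positions = begin
      length positions                          ≡⟨ length-map pos (earlierNeighbours c ++ zs) ⟩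
      length (earlierNeighbours c ++ zs)        ≡⟨ length-++ (earlierNeighbours c) ⟩
      length (earlierNeighbours c) + length zs  ≡⟨ cong (_+ length zs) (predDegree≡ c) ⟩
      k ⊓ pos c + length zs                     ∎

  earlierNonNeighbours≤ : ∀ {c zs} j → pos c ≡ k + j → Unique zs → All (EarlierNonNeighbour c) zs →
                          length zs ≤ j
  earlierNonNeighbours≤ {c} {zs} j c≡k+j uzs czs = +-cancelˡ-≤ k (length zs) j
    (subst₂ (λ m p → m + length zs ≤ p) (m≤n⇒m⊓n≡m k≤c) c≡k+j (earlierNonNeighbours-bound uzs czs))
    where
    k≤c : k ≤ pos c
    k≤c = subst (k ≤_) (sym c≡k+j) (m≤m+n k j)

  initial-earlier-adjacent : ∀ {a b} → pos a < pos b → pos b ≤ k → Adj G b a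
  initial-earlier-adjacent {a} {b} a<b b≤k with Adj? b a
  ... | yes ba = ba
  ... | no ¬ba = ⊥-elim (m+1+n≰m (pos b) (subst (λ m → m + 1 ≤ pos b) (m≥n⇒m⊓n≡n b≤k)
                                               (earlierNonNeighbours-bound ([] ∷ []) ((a<b , ¬ba) ∷ []))))

  initial-adjacent : ∀ {a b} → pos a ≤ k → pos b ≤ k → a ≢ b → Adj G a b
  initial-adjacent {a} {b} a≤k b≤k a≢b with <-cmp (pos a) (pos b)
  ... | tri< a<b _ _ = Adj-sym (initial-earlier-adjacent a<b b≤k)
  ... | tri≈ _ a≡b _ = ⊥-elim (a≢b (pos-injective a≡b))
  ... | tri> _ _ b<a = initial-earlier-adjacent b<a a≤k

  Child : Fin n → Fin n → Set
  Child u c = Adj G u c × pos u < pos c × k < pos c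

  Childless : Fin n → Set
  Childless u = ∀ c → ¬ Child u c

  AtMostOneChild : Fin n → Set
  AtMostOneChild u = ∀ {c d} → Child u c → Child u d → c ≡ d

  data EdgeShape (a b : Fin n) : Set where
    parent  : Child a b → EdgeShape a b
    child   : Child b a → EdgeShape a b
    initial : pos a ≤ k → pos b ≤ k → EdgeShape a b

  edgeShape : ∀ {a b} → Adj G a b → EdgeShape a b
  edgeShape {a} {b} ab with <-cmp (pos a) (pos b)
  ... | tri≈ _ a≡b _ = ⊥-elim (Adj⇒≢ ab (pos-injective a≡b))
  ... | tri< a<b _ _ with suc k ≤? pos b
  ...   | yes k<b = parent (ab , a<b , k<b)
  ...   | no  k≮b = initial (≤-trans (<⇒≤ a<b) (≮⇒≥ k≮b)) (≮⇒≥ k≮b)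
  edgeShape {a} {b} ab | tri> _ _ b<a with suc k ≤? pos a
  ...   | yes k<a = child (Adj-sym ab , b<a , k<a)
  ...   | no  k≮a = initial (≮⇒≥ k≮a) (≤-trans (<⇒≤ b<a) (≮⇒≥ k≮a))

  childless⇒nonNeighbour : ∀ {x c} → Childless x → pos x < pos c → k < pos c → EarlierNonNeighbour c x
  childless⇒nonNeighbour x-none x<c k<c = x<c , λ cx → x-none _ (Adj-sym cx , x<c , k<c)

  initial-child : ∀ {v c} → pos v ≤ k → k < pos c → Adj G c v → Child v c
  initial-child v≤k k<c cv = Adj-sym cv , ≤-<-trans v≤k k<c , k<c

  otherChild⇒nonNeighbour : ∀ {v d c} → AtMostOneChild v → Child v d → c ≢ d →
                            pos v < pos c → k < pos c → EarlierNonNeighbour c v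
  otherChild⇒nonNeighbour v-one vd c≢d v<c k<c = v<c , λ cv → c≢d (v-one (Adj-sym cv , v<c , k<c) vd)

  module _ (k<n : k < n) where

    initialVertex : Fin (suc k) → Fin n
    initialVertex i = ψ (inject≤ i k<n)

    pos-initialVertex : ∀ i → pos (initialVertex i) ≡ toℕ i
    pos-initialVertex i = trans (pos-ψ _) (toℕ-inject≤ i k<n)

    NonChildNeighbour : Fin n → Fin n → Set
    NonChildNeighbour u z = Adj G u z × ¬ Child u z

    nonChildNeighbours : ∀ u → ∃[ zs ] (Unique zs × length zs ≡ k × All (NonChildNeighbour u) zs)
    nonChildNeighbours u with k ≤? pos u
    ... | yes k≤u = earlierNeighbours u ,
                    earlierNeighbours-unique u ,
                    trans (predDegree≡ u) (m≤n⇒m⊓n≡m k≤u) ,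
                    All.tabulate λ z∈ → let uz , z<u = ∈-earlierNeighbours⁻ z∈ in
                                        uz , λ (_ , u<z , _) → <-asym z<u u<z
    ... | no k≰u = map (initialVertex ∘ punchIn p) (allFinL k) ,
                   Unique.map⁺ injective (Unique.allFin⁺ k) ,
                   trans (length-map _ (allFinL k)) (length-tabulate _) ,
                   All.map⁺ (All.universal neighbour _)
      where
      u≤k : pos u ≤ k
      u≤k = <⇒≤ (≰⇒> k≰u)
      p : Fin (suc k)
      p = fromℕ< (s≤s u≤k)
      injective : ∀ {i j} → initialVertex (punchIn p i) ≡ initialVertex (punchIn p j) → i ≡ j
      injective eq = punchIn-injective p _ _ (inject≤-injective k<n k<n _ _ (ψ-injective eq))
      neighbour : ∀ i → NonChildNeighbour u (initialVertex (punchIn p i))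
      neighbour i = initial-adjacent u≤k z≤k u≢z , λ (_ , _ , k<z) → <⇒≱ k<z z≤k
        where
        z≤k : pos (initialVertex (punchIn p i)) ≤ k
        z≤k = subst (_≤ k) (sym (pos-initialVertex _)) (toℕ≤pred[n] (punchIn p i))
        open ≡-Reasoning
        u≢z : u ≢ initialVertex (punchIn p i)
        u≢z u≡z = punchInᵢ≢i p i (toℕ-injective (begin
          toℕ (punchIn p i)                   ≡⟨ pos-initialVertex _ ⟨
          pos (initialVertex (punchIn p i))   ≡⟨ cong pos u≡z ⟨
          pos u                               ≡⟨ toℕ-fromℕ< (s≤s u≤k) ⟨
          toℕ p                               ∎))

    k+children≤degree : ∀ {u cs} → Unique cs → All (Child u) cs → k + length cs ≤ degree G u
    k+children≤degree {u} {cs} ucs u→cs with zs , uzs , |zs|≡k , u→zs ← nonChildNeighbours u =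
      subst (_≤ degree G u) (trans (length-++ zs) (cong (_+ length cs) |zs|≡k))
        (Unique-Adj⇒length≤degree (Unique.++⁺ uzs ucs disjoint)
                                  (All.++⁺ (All.map proj₁ u→zs) (All.map proj₁ u→cs)))
      where
      disjoint : ∀ {z} → ¬ (z ∈ zs × z ∈ cs)
      disjoint (z∈zs , z∈cs) = proj₂ (All.lookup u→zs z∈zs) (All.lookup u→cs z∈cs)

    degree≤k⇒childless : ∀ {u} → degree G u ≤ k → Childless u
    degree≤k⇒childless du c uc = m+1+n≰m k (≤-trans (k+children≤degree ([] ∷ []) (uc ∷ [])) du)

    degree≡1+k⇒atMostOneChild : ∀ {u} → degree G u ≡ suc k → AtMostOneChild u
    degree≡1+k⇒atMostOneChild du {c} {d} uc ud with c ≟ d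
    ... | yes c≡d = c≡d
    ... | no  c≢d = ⊥-elim (n≮n 1 (+-cancelˡ-≤ k 2 1 (subst (k + 2 ≤_) (trans du (+-comm 1 k))
                      (k+children≤degree ((c≢d ∷ []) ∷ [] ∷ []) (uc ∷ ud ∷ [])))))

  module AfterInitialClique (k+4≤n : k + 4 ≤ n) where

    k+j<n : ∀ {j} → j < 4 → k + j < n
    k+j<n j<4 = <-≤-trans (+-monoʳ-< k j<4) k+4≤n

    k<n : k < n
    k<n = subst (_< n) (+-identityʳ k) (k+j<n (s≤s z≤n))

    late : (j : ℕ) → j < 4 → Fin n
    late j j<4 = ψ (fromℕ< (k+j<n j<4))

    pos-late : ∀ j (j<4 : j < 4) → pos (late j j<4) ≡ k + j
    pos-late j j<4 = trans (pos-ψ _) (toℕ-fromℕ< (k+j<n j<4))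

    k<late : ∀ {j} (j<4 : j < 4) → 0 < j → k < pos (late j j<4)
    k<late {j} j<4 0<j = subst (k <_) (sym (pos-late j j<4)) (m<m+n k 0<j)

    late<late : ∀ {i j} (i<4 : i < 4) (j<4 : j < 4) → i < j → pos (late i i<4) < pos (late j j<4)
    late<late {i} {j} i<4 j<4 i<j = subst₂ _<_ (sym (pos-late i i<4)) (sym (pos-late j j<4)) (+-monoʳ-< k i<j)

    1<4 : 1 < 4
    1<4 = s≤s (s≤s z≤n)
    2<4 : 2 < 4
    2<4 = s≤s (s≤s (s≤s z≤n))
    3<4 : 3 < 4
    3<4 = ≤-refl

    u₁ u₂ u₃ : Fin n
    u₁ = late 1 1<4
    u₂ = late 2 2<4
    u₃ = late 3 3<4

    k<u₁ : k < pos u₁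
    k<u₁ = k<late 1<4 (s≤s z≤n)
    k<u₂ : k < pos u₂
    k<u₂ = k<late 2<4 (s≤s z≤n)
    k<u₃ : k < pos u₃
    k<u₃ = k<late 3<4 (s≤s z≤n)

    u₁<u₂ : pos u₁ < pos u₂
    u₁<u₂ = late<late 1<4 2<4 ≤-refl
    u₂<u₃ : pos u₂ < pos u₃
    u₂<u₃ = late<late 2<4 3<4 ≤-refl
    u₁<u₃ : pos u₁ < pos u₃
    u₁<u₃ = <-trans u₁<u₂ u₂<u₃

    u₁-nonNeighbours≤1 : ∀ {zs} → Unique zs → All (EarlierNonNeighbour u₁) zs → length zs ≤ 1
    u₁-nonNeighbours≤1 = earlierNonNeighbours≤ 1 (pos-late 1 1<4)
    u₂-nonNeighbours≤2 : ∀ {zs} → Unique zs → All (EarlierNonNeighbour u₂) zs → length zs ≤ 2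
    u₂-nonNeighbours≤2 = earlierNonNeighbours≤ 2 (pos-late 2 2<4)
    u₃-nonNeighbours≤3 : ∀ {zs} → Unique zs → All (EarlierNonNeighbour u₃) zs → length zs ≤ 3
    u₃-nonNeighbours≤3 = earlierNonNeighbours≤ 3 (pos-late 3 3<4)

    initialTriple-impossible : ∀ {v w x} → pos v ≤ k → pos w ≤ k → pos x ≤ k → v ≢ w → x ≢ v → x ≢ w →
                               Childless x → AtMostOneChild v → AtMostOneChild w → ⊥
    initialTriple-impossible {v} {w} {x} v≤k w≤k x≤k v≢w x≢v x≢w x-none v-one w-one
      with Adj? u₁ v | Adj? u₁ w
    ... | no ¬u₁v | _ = n≮n 1 (u₁-nonNeighbours≤1 ((x≢v ∷ []) ∷ [] ∷ [])
          (childless⇒nonNeighbour x-none (≤-<-trans x≤k k<u₁) k<u₁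
          ∷ (≤-<-trans v≤k k<u₁ , ¬u₁v) ∷ []))
    ... | _ | no ¬u₁w = n≮n 1 (u₁-nonNeighbours≤1 ((x≢w ∷ []) ∷ [] ∷ [])
          (childless⇒nonNeighbour x-none (≤-<-trans x≤k k<u₁) k<u₁
          ∷ (≤-<-trans w≤k k<u₁ , ¬u₁w) ∷ []))
    ... | yes u₁v | yes u₁w = n≮n 2 (u₂-nonNeighbours≤2 ((x≢v ∷ x≢w ∷ []) ∷ (v≢w ∷ []) ∷ [] ∷ [])
          (childless⇒nonNeighbour x-none (≤-<-trans x≤k k<u₂) k<u₂
          ∷ otherChild⇒nonNeighbour v-one (initial-child v≤k k<u₁ u₁v) (pos>⇒≢ u₁<u₂)
                                    (≤-<-trans v≤k k<u₂) k<u₂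
          ∷ otherChild⇒nonNeighbour w-one (initial-child w≤k k<u₁ u₁w) (pos>⇒≢ u₁<u₂)
                                    (≤-<-trans w≤k k<u₂) k<u₂
          ∷ []))

    chain-impossible : ∀ {v w x y} → pos v ≤ k → pos x ≤ k → x ≢ v → Child v w → Child w y →
                       Childless x → Childless y → AtMostOneChild v → AtMostOneChild w → ⊥
    chain-impossible {v} {w} {x} {y} v≤k x≤k x≢v vw wy x-none y-none v-one w-one with Adj? u₁ v
    ... | no ¬u₁v = n≮n 1 (u₁-nonNeighbours≤1 ((x≢v ∷ []) ∷ [] ∷ [])
          (childless⇒nonNeighbour x-none (≤-<-trans x≤k k<u₁) k<u₁
          ∷ (≤-<-trans v≤k k<u₁ , ¬u₁v) ∷ []))
    ... | yes u₁v with refl ← v-one (initial-child v≤k k<u₁ u₁v) vw with Adj? u₂ u₁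
    ...   | no ¬u₂u₁ = n≮n 2 (u₂-nonNeighbours≤2
            ((x≢v ∷ pos<⇒≢ (≤-<-trans x≤k k<u₁) ∷ []) ∷ (pos<⇒≢ (≤-<-trans v≤k k<u₁) ∷ []) ∷ [] ∷ [])
            (childless⇒nonNeighbour x-none (≤-<-trans x≤k k<u₂) k<u₂
            ∷ otherChild⇒nonNeighbour v-one vw (pos>⇒≢ u₁<u₂) (≤-<-trans v≤k k<u₂) k<u₂
            ∷ (u₁<u₂ , ¬u₂u₁)
            ∷ []))
    ...   | yes u₂u₁ with refl ← w-one (Adj-sym u₂u₁ , u₁<u₂ , k<u₂) wy = n≮n 3 (u₃-nonNeighbours≤3
            ((x≢v ∷ pos<⇒≢ (≤-<-trans x≤k k<u₁) ∷ pos<⇒≢ (≤-<-trans x≤k k<u₂) ∷ [])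
             ∷ (pos<⇒≢ (≤-<-trans v≤k k<u₁) ∷ pos<⇒≢ (≤-<-trans v≤k k<u₂) ∷ [])
             ∷ (pos<⇒≢ u₁<u₂ ∷ []) ∷ [] ∷ [])
            (childless⇒nonNeighbour x-none (≤-<-trans x≤k k<u₃) k<u₃
            ∷ otherChild⇒nonNeighbour v-one vw (pos>⇒≢ u₁<u₃) (≤-<-trans v≤k k<u₃) k<u₃
            ∷ otherChild⇒nonNeighbour w-one wy (pos>⇒≢ u₂<u₃) u₁<u₃ k<u₃
            ∷ childless⇒nonNeighbour y-none u₂<u₃ k<u₃
            ∷ []))

    twoChildren-impossible : ∀ {v w x y} → pos v ≤ k → pos w ≤ k → v ≢ w → Child v x → Child w y →
                             Childless x → Childless y → AtMostOneChild v → AtMostOneChild w → ⊥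
    twoChildren-impossible {v} {w} {x} {y} v≤k w≤k v≢w vx wy x-none y-none v-one w-one =
      pigeonhole₃ u₁∈ u₂∈ u₃∈ (pos<⇒≢ u₁<u₂) (pos<⇒≢ u₁<u₃) (pos<⇒≢ u₂<u₃)
      where
      OneOf : Fin n → Set
      OneOf c = c ≡ x ⊎ c ≡ y

      oneOf-childless : ∀ {c} → OneOf c → Childless c
      oneOf-childless (inj₁ refl) = x-none
      oneOf-childless (inj₂ refl) = y-none

      nonNeighbour-v : ∀ {c} → k < pos c → ¬ OneOf c → EarlierNonNeighbour c v
      nonNeighbour-v k<c c∉ = otherChild⇒nonNeighbour v-one vx (c∉ ∘ inj₁) (≤-<-trans v≤k k<c) k<c

      nonNeighbour-w : ∀ {c} → k < pos c → ¬ OneOf c → EarlierNonNeighbour c w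
      nonNeighbour-w k<c c∉ = otherChild⇒nonNeighbour w-one wy (c∉ ∘ inj₂) (≤-<-trans w≤k k<c) k<c

      v≢u₁ : v ≢ u₁
      v≢u₁ = pos<⇒≢ (≤-<-trans v≤k k<u₁)
      w≢u₁ : w ≢ u₁
      w≢u₁ = pos<⇒≢ (≤-<-trans w≤k k<u₁)

      u₁∈ : OneOf u₁
      u₁∈ = decidable-stable ((u₁ ≟ x) ⊎-dec (u₁ ≟ y)) λ u₁∉ → n≮n 1 (u₁-nonNeighbours≤1
              ((v≢w ∷ []) ∷ [] ∷ [])
              (nonNeighbour-v k<u₁ u₁∉ ∷ nonNeighbour-w k<u₁ u₁∉ ∷ []))

      u₂∈ : OneOf u₂
      u₂∈ = decidable-stable ((u₂ ≟ x) ⊎-dec (u₂ ≟ y)) λ u₂∉ → n≮n 2 (u₂-nonNeighbours≤2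
              ((v≢w ∷ v≢u₁ ∷ []) ∷ (w≢u₁ ∷ []) ∷ [] ∷ [])
              (nonNeighbour-v k<u₂ u₂∉ ∷ nonNeighbour-w k<u₂ u₂∉
               ∷ childless⇒nonNeighbour (oneOf-childless u₁∈) u₁<u₂ k<u₂ ∷ []))

      u₃∈ : OneOf u₃
      u₃∈ = decidable-stable ((u₃ ≟ x) ⊎-dec (u₃ ≟ y)) λ u₃∉ → n≮n 3 (u₃-nonNeighbours≤3
              ((v≢w ∷ v≢u₁ ∷ pos<⇒≢ (≤-<-trans v≤k k<u₂) ∷ [])
               ∷ (w≢u₁ ∷ pos<⇒≢ (≤-<-trans w≤k k<u₂) ∷ [])
               ∷ (pos<⇒≢ u₁<u₂ ∷ []) ∷ [] ∷ [])
              (nonNeighbour-v k<u₃ u₃∉ ∷ nonNeighbour-w k<u₃ u₃∉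
               ∷ childless⇒nonNeighbour (oneOf-childless u₁∈) u₁<u₃ k<u₃
               ∷ childless⇒nonNeighbour (oneOf-childless u₂∈) u₂<u₃ k<u₃ ∷ []))

    parentEdge-impossible : ∀ {v w x y} → Child v w → Adj G v x → Adj G w y → x ≢ w →
                            Childless x → Childless y → AtMostOneChild v → AtMostOneChild w → ⊥
    parentEdge-impossible vw vx wy x≢w x-none y-none v-one w-one with edgeShape vx | edgeShape wy
    ... | parent vx′      | _               = x≢w (v-one vx′ vw)
    ... | child xv        | _               = x-none _ xv
    ... | initial _ _     | child yw        = y-none _ yw
    ... | initial _ _     | initial w≤k _   = <⇒≱ (proj₂ (proj₂ vw)) w≤k
    ... | initial v≤k x≤k | parent wy′      =
      chain-impossible v≤k x≤k (Adj⇒≢ vx ∘ sym) vw wy′ x-none y-none v-one w-one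

    adjacentPair-impossible : ∀ {v w x y} → Adj G v w → AtMostOneChild v → AtMostOneChild w →
                              Adj G v x → Childless x → x ≢ w → Adj G w y → Childless y → y ≢ v → ⊥
    adjacentPair-impossible vw v-one w-one vx x-none x≢w wy y-none y≢v
      with edgeShape vw | edgeShape vx | edgeShape wy
    ... | parent vw′        | _               | _               =
      parentEdge-impossible vw′ vx wy x≢w x-none y-none v-one w-one
    ... | child wv′         | _               | _               =
      parentEdge-impossible wv′ wy vx y≢v y-none x-none w-one v-one
    ... | initial _ _       | child xv        | _               = x-none _ xv
    ... | initial _ _       | _               | child yw        = y-none _ yw
    ... | initial v≤k w≤k   | initial _ x≤k   | _               =
      initialTriple-impossible v≤k w≤k x≤k (Adj⇒≢ vw) (Adj⇒≢ vx ∘ sym) x≢w x-none v-one w-one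
    ... | initial v≤k w≤k   | _               | initial _ y≤k   =
      initialTriple-impossible w≤k v≤k y≤k (Adj⇒≢ vw ∘ sym) (Adj⇒≢ wy ∘ sym) y≢v y-none w-one v-one
    ... | initial v≤k w≤k   | parent vx′      | parent wy′      =
      twoChildren-impossible v≤k w≤k (Adj⇒≢ vw) vx′ wy′ x-none y-none v-one w-one

lemma5p5 : (k n : ℕ) (G : Graph n) → IsKTree k G → k + 4 ≤ n →
    ¬ (∃[ v ] ∃[ w ] (Adj G v w × degree G v ≡ suc k × degree G w ≡ suc k
        × (∃[ x ] (Adj G v x × degree G x ≤ k))
        × (∃[ y ] (Adj G w y × degree G y ≤ k))))
lemma5p5 k n G (φ , ψ , ψ∘φ , φ∘ψ , _ , predDegree≡) k+4≤n
         (v , w , vw , dv , dw , (x , vx , dx) , (y , wy , dy)) =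
  adjacentPair-impossible vw (degree≡1+k⇒atMostOneChild k<n dv) (degree≡1+k⇒atMostOneChild k<n dw)
    vx (degree≤k⇒childless k<n dx) (λ { refl → n≮n k (subst (_≤ k) dw dx) })
    wy (degree≤k⇒childless k<n dy) (λ { refl → n≮n k (subst (_≤ k) dv dy) })
  where
  open KTreeOrdering G φ ψ ψ∘φ φ∘ψ predDegree≡
  open AfterInitialClique k+4≤n
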